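{- Let $m,n \ge 1$. Identify $\mathbb{R}^{m+1} \otimes \mathbb{R}^{n+1}$ with $\mathbb{R}^A$, where $A$ is the arc set of an orientation $D$ of the complete bipartite graph $\mathsf{K}_{m+1,n+1}$ with vertex classes $\{1,\ldots,m+1\}$ and $\{1,\ldots,n+1\}$, by identifying $e_i \otimes f_j$ with the unit vector of the arc between vertex $i$ of the first class and vertex $j$ of the second class. Then, for a suitable orientation $D$, the tensor product lattice $\mathsf{A}_m \otimes \mathsf{A}_n$ coincides with the graphic lattice $\mathcal{L}(D) \cap \mathbb{Z}^A = \{x \in \mathbb{Z}^A : M(D) x = 0\}$.
   Context: $e_1,\ldots,e_{m+1}$ and $f_1,\ldots,f_{n+1}$ are the standard basis vectors of $\mathbb{R}^{m+1}$ and $\mathbb{R}^{n+1}$. The root lattice is $\mathsf{A}_m = \{x \in \mathbb{Z}^{m+1} : \sum_{i=1}^{m+1} x_i = 0\}$. For lattices $L_1 \subseteq \mathbb{R}^{n_1}$ with basis $a_1,\ldots,a_{r_1}$ and $L_2 \subseteq \mathbb{R}^{n_2}$ with basis $b_1,\ldots,b_{r_2}$, the tensor product $L_1 \otimes L_2 \subseteq \mathbb{R}^{n_1} \otimes \mathbb{R}^{n_2} = \mathbb{R}^{n_1 n_2}$ is the lattice with basis $a_i \otimes b_j$, $i \le r_1$, $j \le r_2$. $M(D) \in \{ -1,0,+1\}^{V \times A}$ is the vertex-arc incidence matrix of the directed graph $D$. -}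

module Defs where

open import Data.Nat using (ℕ; zero; suc)
open import Data.Fin using (Fin; zero; suc; inject₁; toℕ)
open import Data.Integer using (ℤ; +_; _+_; _*_; -_; 0ℤ; 1ℤ)
open import Data.Bool using (Bool; true; false)
open import Data.Sum using (_⊎_; inj₁; inj₂)
open import Data.Product using (_×_; _,_; Σ; ∃)
open import Relation.Binary.PropositionalEquality using (_≡_)
open import Relation.Nullary using (Dec; yes; no)
open import Data.Fin.Properties using (_≟_)

∑ : ∀ {k} → (Fin k → ℤ) → ℤ
∑ {zero}  f = 0ℤ
∑ {suc k} f = f zero + ∑ (λ i → f (suc i))

δ : ∀ {k} → Fin k → Fin k → ℤ
δ i j with i ≟ j
... | yes _ = 1ℤ
... | no  _ = 0ℤ

A : (m : ℕ) → (Fin (suc m) → ℤ) → Set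
A m x = ∑ x ≡ 0ℤ

Abasis : (m : ℕ) → Fin m → Fin (suc m) → ℤ
Abasis m k i = δ (inject₁ k) i + - δ (suc k) i

-- tensor product of lattices L₁ ⊆ ℝ^{n₁}, L₂ ⊆ ℝ^{n₂} given by bases
-- a : Fin r₁ → ℤ^{n₁}, b : Fin r₂ → ℤ^{n₂}; ℝ^{n₁} ⊗ ℝ^{n₂} is ℤ^{n₁ × n₂}
-- (coordinates indexed by pairs), a ⊗ b has (i,j)-entry a i * b j.
_⊗_ : ∀ {n₁ n₂} → (Fin n₁ → ℤ) → (Fin n₂ → ℤ) → Fin n₁ → Fin n₂ → ℤ
(a ⊗ b) i j = a i * b j

TensorLattice : ∀ {r₁ r₂ n₁ n₂} → (Fin r₁ → Fin n₁ → ℤ) → (Fin r₂ → Fin n₂ → ℤ)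
              → (Fin n₁ → Fin n₂ → ℤ) → Set
TensorLattice {r₁} {r₂} a b x =
  Σ (Fin r₁ → Fin r₂ → ℤ) λ c →
    ∀ i j → x i j ≡ ∑ (λ k → ∑ (λ l → c k l * (a k ⊗ b l) i j))

-- An orientation D of K_{m+1,n+1}: vertex classes Fin (suc m), Fin (suc n);
-- arc set A = Fin (suc m) × Fin (suc n);  o i j = true  means the arc goes i → j,
-- false means j → i.
Orientation : ℕ → ℕ → Set
Orientation m n = Fin (suc m) → Fin (suc n) → Bool

Vertex : ℕ → ℕ → Set
Vertex m n = Fin (suc m) ⊎ Fin (suc n)

M : ∀ {m n} → Orientation m n → Vertex m n → Fin (suc m) → Fin (suc n) → ℤ
M o (inj₁ v) i j with o i j
... | true  = δ v i
... | false = - δ v i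
M o (inj₂ v) i j with o i j
... | true  = - δ v j
... | false = δ v j

GraphicLattice : ∀ {m n} → Orientation m n → (Fin (suc m) → Fin (suc n) → ℤ) → Set
GraphicLattice o x = ∀ v → ∑ (λ i → ∑ (λ j → M o v i j * x i j)) ≡ 0ℤ

module Submission where

-- Orient every arc of K_{m+1,n+1} from the first vertex class to the second.
-- Then the incidence condition M(D) x = 0 at a vertex i of the first class says
-- that row i of the (m+1)×(n+1) array x sums to zero, and at a vertex j of the
-- second class that column j sums to zero.  So it suffices to show
--
--     x ∈ A_m ⊗ A_n   ⇔   every row sum and every column sum of x vanishes.
--
-- (⇒) holds for the tensor product of any two lattices spanned by zero-sum
-- vectors: summing a ⊗ b over a row leaves a multiple of ∑ b = 0.
-- (⇐) uses the explicit expansion of a zero-sum vector y ∈ A_m in the basis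
-- e_k - e_{k+1}: its coordinates are the prefix sums y_0 + … + y_k.  Expanding
-- every column of x, and then every row of the resulting coefficient array
-- (whose rows again sum to zero), writes x in the basis of A_m ⊗ A_n.

open import Defs
open import Data.Nat using (ℕ; zero; suc; _≤_)
open import Data.Fin using (Fin; zero; suc; inject₁)
open import Data.Fin.Properties using (_≟_)
open import Data.Integer using (ℤ; _+_; _*_; -_; 0ℤ; 1ℤ)
import Data.Integer.Properties as ℤ
open import Data.Integer.Tactic.RingSolver using (solve-∀)
open import Algebra.Properties.CommutativeSemigroup ℤ.+-commutativeSemigroup
  using (interchange)
open import Data.Bool using (true)
open import Data.Sum using (inj₁; inj₂)
open import Data.Product using (Σ; _×_; _,_)
open import Relation.Binary.PropositionalEquality
open import Relation.Nullary using (yes; no)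
open ≡-Reasoning

∑-cong : ∀ {k} {f g : Fin k → ℤ} → (∀ i → f i ≡ g i) → ∑ f ≡ ∑ g
∑-cong {zero}  e = refl
∑-cong {suc k} e = cong₂ _+_ (e zero) (∑-cong (λ i → e (suc i)))

∑-zero : ∀ {k} {f : Fin k → ℤ} → (∀ i → f i ≡ 0ℤ) → ∑ f ≡ 0ℤ
∑-zero {zero}  e = refl
∑-zero {suc k} e = cong₂ _+_ (e zero) (∑-zero (λ i → e (suc i)))

∑∑-zero : ∀ {p q} {f : Fin p → Fin q → ℤ} → (∀ k l → f k l ≡ 0ℤ) →
  ∑ (λ k → ∑ (λ l → f k l)) ≡ 0ℤ
∑∑-zero e = ∑-zero (λ k → ∑-zero (e k))

∑-+ : ∀ {k} (f g : Fin k → ℤ) → ∑ (λ i → f i + g i) ≡ ∑ f + ∑ g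
∑-+ {zero}  f g = refl
∑-+ {suc k} f g = begin
  (f zero + g zero) + ∑ (λ i → f (suc i) + g (suc i))
    ≡⟨ cong (f zero + g zero +_) (∑-+ (λ i → f (suc i)) (λ i → g (suc i))) ⟩
  (f zero + g zero) + (∑ (λ i → f (suc i)) + ∑ (λ i → g (suc i)))
    ≡⟨ interchange (f zero) (g zero) _ _ ⟩
  ∑ f + ∑ g ∎

∑-*ˡ : ∀ {k} (c : ℤ) (f : Fin k → ℤ) → ∑ (λ i → c * f i) ≡ c * ∑ f
∑-*ˡ {zero}  c f = sym (ℤ.*-zeroʳ c)
∑-*ˡ {suc k} c f = begin
  c * f zero + ∑ (λ i → c * f (suc i))
    ≡⟨ cong (c * f zero +_) (∑-*ˡ c (λ i → f (suc i))) ⟩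
  c * f zero + c * ∑ (λ i → f (suc i))
    ≡⟨ ℤ.*-distribˡ-+ c (f zero) _ ⟨
  c * ∑ f ∎

∑-neg : ∀ {k} (f : Fin k → ℤ) → ∑ (λ i → - f i) ≡ - ∑ f
∑-neg {zero}  f = refl
∑-neg {suc k} f = begin
  - f zero + ∑ (λ i → - f (suc i))
    ≡⟨ cong (- f zero +_) (∑-neg (λ i → f (suc i))) ⟩
  - f zero + - ∑ (λ i → f (suc i))
    ≡⟨ ℤ.neg-distrib-+ (f zero) _ ⟨
  - ∑ f ∎

∑-swap : ∀ {k l} (f : Fin k → Fin l → ℤ) →
  ∑ (λ i → ∑ (λ j → f i j)) ≡ ∑ (λ j → ∑ (λ i → f i j))
∑-swap {zero} {l} f = sym (∑-zero {l} (λ j → refl))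
∑-swap {suc k} f = begin
  ∑ (f zero) + ∑ (λ i → ∑ (λ j → f (suc i) j))
    ≡⟨ cong (∑ (f zero) +_) (∑-swap (λ i → f (suc i))) ⟩
  ∑ (f zero) + ∑ (λ j → ∑ (λ i → f (suc i) j))
    ≡⟨ ∑-+ (f zero) (λ j → ∑ (λ i → f (suc i) j)) ⟨
  ∑ (λ j → ∑ (λ i → f i j)) ∎

∑-swap₃ : ∀ {p q r} (f : Fin p → Fin q → Fin r → ℤ) →
  ∑ (λ j → ∑ (λ k → ∑ (λ l → f j k l))) ≡ ∑ (λ k → ∑ (λ l → ∑ (λ j → f j k l)))
∑-swap₃ f = trans (∑-swap (λ j k → ∑ (f j k)))
                  (∑-cong (λ k → ∑-swap (λ j l → f j k l)))

δ-suc : ∀ {k} (a b : Fin k) → δ (suc a) (suc b) ≡ δ a b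
δ-suc a b with a ≟ b
... | yes _ = refl
... | no  _ = refl

∑-δ : ∀ {k} (v : Fin k) (g : Fin k → ℤ) → ∑ (λ i → δ v i * g i) ≡ g v
∑-δ zero g = begin
  1ℤ * g zero + ∑ (λ i → 0ℤ * g (suc i))
    ≡⟨ cong (1ℤ * g zero +_) (∑-zero (λ i → ℤ.*-zeroˡ (g (suc i)))) ⟩
  1ℤ * g zero + 0ℤ
    ≡⟨ trans (ℤ.+-identityʳ _) (ℤ.*-identityˡ (g zero)) ⟩
  g zero ∎
∑-δ (suc v) g = begin
  0ℤ * g zero + ∑ (λ i → δ (suc v) (suc i) * g (suc i))
    ≡⟨ cong (0ℤ * g zero +_) (∑-cong (λ i → cong (_* g (suc i)) (δ-suc v i))) ⟩
  0ℤ + ∑ (λ i → δ v i * g (suc i))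
    ≡⟨ ℤ.+-identityˡ _ ⟩
  ∑ (λ i → δ v i * g (suc i))
    ≡⟨ ∑-δ v (λ i → g (suc i)) ⟩
  g (suc v) ∎

∑-δ-one : ∀ {k} (v : Fin k) → ∑ (δ v) ≡ 1ℤ
∑-δ-one v = trans (∑-cong (λ i → sym (ℤ.*-identityʳ (δ v i)))) (∑-δ v (λ _ → 1ℤ))

∑-Abasis : ∀ m (k : Fin m) → ∑ (Abasis m k) ≡ 0ℤ
∑-Abasis m k = begin
  ∑ (λ i → δ (inject₁ k) i + - δ (suc k) i)
    ≡⟨ ∑-+ (δ (inject₁ k)) (λ i → - δ (suc k) i) ⟩
  ∑ (δ (inject₁ k)) + ∑ (λ i → - δ (suc k) i)
    ≡⟨ cong₂ _+_ (∑-δ-one (inject₁ k)) (trans (∑-neg (δ (suc k))) (cong -_ (∑-δ-one (suc k)))) ⟩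
  0ℤ ∎

Abasis-suc : ∀ m (k : Fin m) (i : Fin (suc m)) →
  Abasis (suc m) (suc k) (suc i) ≡ Abasis m k i
Abasis-suc m k i = cong₂ _+_ (δ-suc (inject₁ k) i) (cong -_ (δ-suc (suc k) i))

merge : ∀ {m} → (Fin (suc (suc m)) → ℤ) → Fin (suc m) → ℤ
merge y zero    = y zero + y (suc zero)
merge y (suc i) = y (suc (suc i))

∑-merge : ∀ {m} (y : Fin (suc (suc m)) → ℤ) → ∑ (merge y) ≡ ∑ y
∑-merge y = ℤ.+-assoc (y zero) (y (suc zero)) _

-- Prefix sums: prefix y k = y_0 + … + y_k, the coordinates of y ∈ A_m in the
-- basis e_k - e_{k+1}.
prefix : ∀ {m} → (Fin (suc m) → ℤ) → Fin m → ℤ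
prefix {suc m} y zero    = y zero
prefix {suc m} y (suc k) = prefix (merge y) k

prefix-expansion : ∀ {m} (y : Fin (suc m) → ℤ) → ∑ y ≡ 0ℤ →
  ∀ i → y i ≡ ∑ (λ k → prefix y k * Abasis m k i)
prefix-expansion {zero}  y s zero = trans (sym (ℤ.+-identityʳ (y zero))) s
prefix-expansion {suc m} y s zero = sym (begin
  y zero * (1ℤ + - 0ℤ) + ∑ (λ k → prefix (merge y) k * 0ℤ)
    ≡⟨ cong (y zero * 1ℤ +_) (∑-zero (λ k → ℤ.*-zeroʳ (prefix (merge y) k))) ⟩
  y zero * 1ℤ + 0ℤ
    ≡⟨ trans (ℤ.+-identityʳ _) (ℤ.*-identityʳ (y zero)) ⟩
  y zero ∎)
prefix-expansion {suc m} y s (suc i) = sym (begin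
  y zero * Abasis (suc m) zero (suc i)
    + ∑ (λ k → prefix (merge y) k * Abasis (suc m) (suc k) (suc i))
    ≡⟨ cong (y zero * Abasis (suc m) zero (suc i) +_)
         (∑-cong (λ k → cong (prefix (merge y) k *_) (Abasis-suc m k i))) ⟩
  y zero * Abasis (suc m) zero (suc i) + ∑ (λ k → prefix (merge y) k * Abasis m k i)
    ≡⟨ cong (y zero * Abasis (suc m) zero (suc i) +_)
         (prefix-expansion (merge y) (trans (∑-merge y) s) i) ⟨
  y zero * Abasis (suc m) zero (suc i) + merge y i
    ≡⟨ first-step i ⟩
  y (suc i) ∎)
  where
  -- Only e_0 - e_1 meets coordinate 1, where it cancels the merged y_0.
  first-step : ∀ i → y zero * Abasis (suc m) zero (suc i) + merge y i ≡ y (suc i)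
  first-step zero    = cancel (y zero) (y (suc zero))
    where
    cancel : ∀ a b → a * (0ℤ + - 1ℤ) + (a + b) ≡ b
    cancel = solve-∀
  first-step (suc j) = begin
    y zero * (0ℤ + - δ (suc zero) (suc (suc j))) + y (suc (suc j))
      ≡⟨ cong (λ d → y zero * (0ℤ + - d) + y (suc (suc j))) (δ-suc zero (suc j)) ⟩
    y zero * 0ℤ + y (suc (suc j))
      ≡⟨ cong (_+ y (suc (suc j))) (ℤ.*-zeroʳ (y zero)) ⟩
    0ℤ + y (suc (suc j))
      ≡⟨ ℤ.+-identityˡ _ ⟩
    y (suc (suc j)) ∎

-- Prefix sums are taken row-wise by merging rows, so if every row of x sums to
-- zero, so does every row of the array of column prefix sums.
prefix-rows : ∀ {m l} (x : Fin (suc m) → Fin l → ℤ) → (∀ i → ∑ (x i) ≡ 0ℤ) →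
  ∀ k → ∑ (λ j → prefix (λ i → x i j) k) ≡ 0ℤ
prefix-rows {suc m} x rows zero    = rows zero
prefix-rows {suc m} x rows (suc k) = prefix-rows (λ i j → merge (λ i′ → x i′ j) i) merged-rows k
  where
  merged-rows : ∀ i → ∑ (λ j → merge (λ i′ → x i′ j) i) ≡ 0ℤ
  merged-rows zero    = trans (∑-+ (x zero) (x (suc zero)))
                              (cong₂ _+_ (rows zero) (rows (suc zero)))
  merged-rows (suc i) = rows (suc (suc i))

ZeroMargins : ∀ {n₁ n₂} → (Fin n₁ → Fin n₂ → ℤ) → Set
ZeroMargins x = (∀ i → ∑ (λ j → x i j) ≡ 0ℤ) × (∀ j → ∑ (λ i → x i j) ≡ 0ℤ)

∑-scaled-zero : ∀ {k} (c : ℤ) (f : Fin k → ℤ) → ∑ f ≡ 0ℤ → ∑ (λ j → c * f j) ≡ 0ℤ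
∑-scaled-zero c f s = begin
  ∑ (λ j → c * f j) ≡⟨ ∑-*ˡ c f ⟩
  c * ∑ f           ≡⟨ cong (c *_) s ⟩
  c * 0ℤ            ≡⟨ ℤ.*-zeroʳ c ⟩
  0ℤ                ∎

tensor-row-sums : ∀ {r₁ r₂ n₁ n₂} (a : Fin r₁ → Fin n₁ → ℤ) (b : Fin r₂ → Fin n₂ → ℤ) →
  (∀ l → ∑ (b l) ≡ 0ℤ) → ∀ x → TensorLattice a b x → ∀ i → ∑ (λ j → x i j) ≡ 0ℤ
tensor-row-sums a b ∑b x (c , e) i = begin
  ∑ (λ j → x i j)
    ≡⟨ ∑-cong (e i) ⟩
  ∑ (λ j → ∑ (λ k → ∑ (λ l → c k l * (a k i * b l j))))
    ≡⟨ ∑-swap₃ (λ j k l → c k l * (a k i * b l j)) ⟩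
  ∑ (λ k → ∑ (λ l → ∑ (λ j → c k l * (a k i * b l j))))
    ≡⟨ ∑∑-zero (λ k l → trans (∑-cong (λ j → sym (ℤ.*-assoc (c k l) (a k i) (b l j))))
                              (∑-scaled-zero (c k l * a k i) (b l) (∑b l))) ⟩
  0ℤ ∎

tensor-column-sums : ∀ {r₁ r₂ n₁ n₂} (a : Fin r₁ → Fin n₁ → ℤ) (b : Fin r₂ → Fin n₂ → ℤ) →
  (∀ k → ∑ (a k) ≡ 0ℤ) → ∀ x → TensorLattice a b x → ∀ j → ∑ (λ i → x i j) ≡ 0ℤ
tensor-column-sums a b ∑a x (c , e) j = begin
  ∑ (λ i → x i j)
    ≡⟨ ∑-cong (λ i → e i j) ⟩
  ∑ (λ i → ∑ (λ k → ∑ (λ l → c k l * (a k i * b l j))))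
    ≡⟨ ∑-swap₃ (λ i k l → c k l * (a k i * b l j)) ⟩
  ∑ (λ k → ∑ (λ l → ∑ (λ i → c k l * (a k i * b l j))))
    ≡⟨ ∑∑-zero (λ k l → trans (∑-cong (λ i → regroup (c k l) (a k i) (b l j)))
                              (∑-scaled-zero (c k l * b l j) (a k) (∑a k))) ⟩
  0ℤ ∎
  where
  regroup : ∀ c p q → c * (p * q) ≡ (c * q) * p
  regroup = solve-∀

tensor⇒zero-margins : ∀ {r₁ r₂ n₁ n₂} (a : Fin r₁ → Fin n₁ → ℤ) (b : Fin r₂ → Fin n₂ → ℤ) →
  (∀ k → ∑ (a k) ≡ 0ℤ) → (∀ l → ∑ (b l) ≡ 0ℤ) →
  ∀ x → TensorLattice a b x → ZeroMargins x
tensor⇒zero-margins a b ∑a ∑b x t =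
  tensor-row-sums a b ∑b x t , tensor-column-sums a b ∑a x t

-- Conversely, an array with zero margins lies in A_m ⊗ A_n: expand each column
-- in A_m by prefix sums, then each row of the coefficient array in A_n.
zero-margins⇒tensor : ∀ {m n} (x : Fin (suc m) → Fin (suc n) → ℤ) →
  ZeroMargins x → TensorLattice (Abasis m) (Abasis n) x
zero-margins⇒tensor {m} {n} x (rows , columns) = c , expansion
  where
  P : Fin m → Fin (suc n) → ℤ
  P k j = prefix (λ i → x i j) k

  c : Fin m → Fin n → ℤ
  c k = prefix (P k)

  regroup : ∀ p c q → p * (c * q) ≡ c * (p * q)
  regroup = solve-∀

  expansion : ∀ i j → x i j ≡ ∑ (λ k → ∑ (λ l → c k l * (Abasis m k i * Abasis n l j)))
  expansion i j = begin
    x i j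
      ≡⟨ prefix-expansion (λ i′ → x i′ j) (columns j) i ⟩
    ∑ (λ k → P k j * Abasis m k i)
      ≡⟨ ∑-cong (λ k → ℤ.*-comm (P k j) (Abasis m k i)) ⟩
    ∑ (λ k → Abasis m k i * P k j)
      ≡⟨ ∑-cong (λ k → cong (Abasis m k i *_) (prefix-expansion (P k) (prefix-rows x rows k) j)) ⟩
    ∑ (λ k → Abasis m k i * ∑ (λ l → c k l * Abasis n l j))
      ≡⟨ ∑-cong (λ k → ∑-*ˡ (Abasis m k i) (λ l → c k l * Abasis n l j)) ⟨
    ∑ (λ k → ∑ (λ l → Abasis m k i * (c k l * Abasis n l j)))
      ≡⟨ ∑-cong (λ k → ∑-cong (λ l → regroup (Abasis m k i) (c k l) (Abasis n l j))) ⟩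
    ∑ (λ k → ∑ (λ l → c k l * (Abasis m k i * Abasis n l j))) ∎

forward : ∀ m n → Orientation m n
forward m n _ _ = true

outflow : ∀ {m n} (x : Fin (suc m) → Fin (suc n) → ℤ) v →
  ∑ (λ i → ∑ (λ j → M (forward m n) (inj₁ v) i j * x i j)) ≡ ∑ (λ j → x v j)
outflow x v = begin
  ∑ (λ i → ∑ (λ j → δ v i * x i j))
    ≡⟨ ∑-cong (λ i → ∑-*ˡ (δ v i) (x i)) ⟩
  ∑ (λ i → δ v i * ∑ (x i))
    ≡⟨ ∑-δ v (λ i → ∑ (x i)) ⟩
  ∑ (x v) ∎

inflow : ∀ {m n} (x : Fin (suc m) → Fin (suc n) → ℤ) v →
  ∑ (λ i → ∑ (λ j → M (forward m n) (inj₂ v) i j * x i j)) ≡ - ∑ (λ i → x i v)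
inflow x v = begin
  ∑ (λ i → ∑ (λ j → - δ v j * x i j))
    ≡⟨ ∑-cong (λ i → ∑-cong (λ j → sym (ℤ.neg-distribˡ-* (δ v j) (x i j)))) ⟩
  ∑ (λ i → ∑ (λ j → - (δ v j * x i j)))
    ≡⟨ ∑-cong (λ i → trans (∑-neg (λ j → δ v j * x i j)) (cong -_ (∑-δ v (x i)))) ⟩
  ∑ (λ i → - x i v)
    ≡⟨ ∑-neg (λ i → x i v) ⟩
  - ∑ (λ i → x i v) ∎

zero-margins⇒graphic : ∀ {m n} (x : Fin (suc m) → Fin (suc n) → ℤ) →
  ZeroMargins x → GraphicLattice (forward m n) x
zero-margins⇒graphic x (rows , columns) (inj₁ v) = trans (outflow x v) (rows v)
zero-margins⇒graphic x (rows , columns) (inj₂ v) =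
  trans (inflow x v) (cong -_ (columns v))

graphic⇒zero-margins : ∀ {m n} (x : Fin (suc m) → Fin (suc n) → ℤ) →
  GraphicLattice (forward m n) x → ZeroMargins x
graphic⇒zero-margins x g =
  (λ v → trans (sym (outflow x v)) (g (inj₁ v))) ,
  (λ v → ℤ.neg-injective (trans (sym (inflow x v)) (g (inj₂ v))))

proposition2p5 : (m n : ℕ) → 1 ≤ m → 1 ≤ n →
    Σ (Orientation m n) λ D →
      (x : Fin (suc m) → Fin (suc n) → ℤ) →
        (TensorLattice (Abasis m) (Abasis n) x → GraphicLattice D x)
        × (GraphicLattice D x → TensorLattice (Abasis m) (Abasis n) x)
proposition2p5 m n _ _ = forward m n , λ x →
  (λ t → zero-margins⇒graphic x
           (tensor⇒zero-margins (Abasis m) (Abasis n) (∑-Abasis m) (∑-Abasis n) x t)) ,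
  (λ g → zero-margins⇒tensor x (graphic⇒zero-margins x g))
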